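{- (1) Let $\sigma_1:\Delta'_1\to\Delta_1$ and $\sigma_2:\Delta'_2\to\Delta_2$ be homology subdivisions, where $\Delta_1,\Delta_2$ (and $\Delta'_1,\Delta'_2$) have disjoint ground sets, and let $\sigma:\Delta'_1*\Delta'_2\to\Delta_1*\Delta_2$ be given by $\sigma(E_1\cup E_2)=\sigma_1(E_1)\cup\sigma_2(E_2)$ (a homology subdivision). If $\sigma_1$ and $\sigma_2$ are both vertex-induced (respectively, both flag), then so is $\sigma$. (2) Let $\sigma:\Delta'\to\Delta$ be a homology subdivision and $F$ a common face of $\Delta$ and $\Delta'$ with $\sigma(F)=F$, and let $\sigma_F:\mathrm{link}_{\Delta'}(F)\to\mathrm{link}_\Delta(F)$, $\sigma_F(E)=\sigma(E\cup F)\setminus F$ (a homology subdivision). If $\sigma$ is vertex-induced (respectively, flag), then so is $\sigma_F$.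
   Context: Fix a field $\mathbb{k}$. Simplicial complexes are finite abstract; $\mathrm{link}_\Delta(F)=\{G\setminus F: G\in\Delta, F\subseteq G\}$; the simplicial join $\Delta_1*\Delta_2$ of complexes on disjoint ground sets is $\{F_1\cup F_2: F_1\in\Delta_1,F_2\in\Delta_2\}$. A complex is flag if every minimal non-face has two elements. Homology spheres and balls over $\mathbb{k}$: a $(d-1)$-dimensional complex $\Delta$ is a homology sphere if for every $F\in\Delta$ (including $\varnothing$) $\widetilde H_i(\mathrm{link}_\Delta(F);\mathbb{k})$ is $\mathbb{k}$ for $i=\dim\mathrm{link}_\Delta(F)$ and $0$ otherwise; a homology ball if there is a subcomplex $\partial\Delta$, a $(d-2)$-dimensional homology sphere, with $\widetilde H_i(\mathrm{link}_\Delta(F);\mathbb{k})$ equal to $\mathbb{k}$ if $F\notin\partial\Delta$ and $i=\dim\mathrm{link}_\Delta(F)$ and $0$ otherwise, for all $F\in\Delta$; its interior is $\Delta\setminus\partial\Delta$. A homology subdivision of $\Delta$ is a complex $\Delta'$ with a map $\sigma:\Delta'\to\Delta$ such that for each $F\in\Delta$, $\Delta'_F:=\sigma^{ -1}(2^F)$ is a subcomplex which is a homology ball of dimension $\dim F$ with interior $\sigma^{ -1}(F)$. It is vertex-induced if for all $E\in\Delta'$, $F\in\Delta$: if every vertex of $E$ is a vertex of $\Delta'_F$ then $E\in\Delta'_F$; it is flag if every $\Delta'_F$ is a flag complex. -}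

module Defs where

open import Level using (Level; _⊔_)
open import Data.Bool.ListAction using (any)
open import Data.Nat using (ℕ; zero; suc; _≤_; _≡ᵇ_)
open import Data.Bool using (Bool; true; false; not; _∧_; _∨_; if_then_else_)
open import Data.Vec using (Vec; []; _∷_)
open import Data.Fin using (Fin)
open import Data.Fin.Subset using (Subset; ⁅_⁆; _∈_; _∩_; _∪_; _─_; ∁; ∣_∣; ⊥; ⊤)
open import Data.List using (List; []; _∷_; _++_; map; foldr)
open import Data.Product using (Σ; ∃; _×_; _,_)
open import Data.Sum using (_⊎_)
open import Relation.Nullary using (¬_)
open import Relation.Binary.PropositionalEquality using (_≡_; _≢_)
open import Algebra.Bundles using (CommutativeRing)

record Field (c ℓ : Level) : Set (Level.suc (c ⊔ ℓ)) where
  field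
    commutativeRing : CommutativeRing c ℓ
  open CommutativeRing commutativeRing public
  field
    1≉0     : ¬ (1# ≈ 0#)
    inverse : ∀ x → ¬ (x ≈ 0#) → ∃ λ y → x * y ≈ 1#

-- Finite sets of vertices: all vertices live in an ambient Fin n.
-- A face is a Subset n; a (finite abstract) simplicial complex is
-- given by its decidable membership predicate Subset n → Bool.

Face : ℕ → Set
Face n = Subset n

Cx : ℕ → Set
Cx n = Face n → Bool

allSubsets : (n : ℕ) → List (Subset n)
allSubsets zero    = [] ∷ []
allSubsets (suc n) = map (false ∷_) (allSubsets n) ++ map (true ∷_) (allSubsets n)

_⊆ᵇ_ : ∀ {n} → Subset n → Subset n → Bool
[]      ⊆ᵇ []      = true
(true ∷ p)  ⊆ᵇ (false ∷ q) = false
(_ ∷ p) ⊆ᵇ (_ ∷ q) = p ⊆ᵇ q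

_==ᵇ_ : ∀ {n} → Subset n → Subset n → Bool
[] ==ᵇ [] = true
(true ∷ p)  ==ᵇ (true ∷ q)  = p ==ᵇ q
(false ∷ p) ==ᵇ (false ∷ q) = p ==ᵇ q
(_ ∷ p)     ==ᵇ (_ ∷ q)     = false

module _ {n : ℕ} where

  IsComplex : Cx n → Set
  IsComplex Δ = ∀ G H → H Data.Fin.Subset.⊆ G → Δ G ≡ true → Δ H ≡ true

  _⊑_ : Cx n → Cx n → Set
  Δ₁ ⊑ Δ₂ = ∀ G → Δ₁ G ≡ true → Δ₂ G ≡ true

  vertices : Cx n → Subset n
  vertices Δ = Data.Vec.tabulate (λ i → Δ ⁅ i ⁆)

  -- link_Δ(F) = { G ∖ F : G ∈ Δ, F ⊆ G } = { H : H ∩ F = ∅, H ∪ F ∈ Δ }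
  link : Cx n → Face n → Cx n
  link Δ F H = ((H ∩ F) ==ᵇ ⊥) ∧ Δ (H ∪ F)

  join : Cx n → Cx n → Cx n
  join Δ₁ Δ₂ G =
    any (λ F₁ → any (λ F₂ →
      Δ₁ F₁ ∧ Δ₂ F₂ ∧ ((F₁ ∪ F₂) ==ᵇ G)) (allSubsets n)) (allSubsets n)

  DisjointVertices : Cx n → Cx n → Set
  DisjointVertices Δ₁ Δ₂ = (vertices Δ₁ ∩ vertices Δ₂) ≡ ⊥

  -- Δ is (d-1)-dimensional, i.e. its largest faces have d elements
  HasSize : Cx n → ℕ → Set
  HasSize Δ d = (∃ λ G → Δ G ≡ true × ∣ G ∣ ≡ d)
              × (∀ G → Δ G ≡ true → ∣ G ∣ ≤ d)

  IsFlag : Cx n → Set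
  IsFlag Δ = ∀ G → G Data.Fin.Subset.⊆ vertices Δ → Δ G ≡ false
           → (∀ H → H Data.Fin.Subset.⊂ G → Δ H ≡ true) → ∣ G ∣ ≡ 2

-- Reduced simplicial homology over a field, indexed by face size
-- s = i + 1 (so s = 0 is homological degree -1, the empty face).
-- Faces are oriented by the order of Fin n.

-- parity of the number of elements of G preceding the unique element
-- of H ∖ G (G ⊂ H with |H| = |G| + 1): the incidence sign [H : G]
signOdd : ∀ {n} → Subset n → Subset n → Bool
signOdd []          []          = false
signOdd (true ∷ h)  (false ∷ g) = false
signOdd (_ ∷ h)     (true ∷ g)  = not (signOdd h g)
signOdd (false ∷ h) (false ∷ g) = signOdd h g

module Homology {c ℓ : Level} (K : Field c ℓ) {n : ℕ} where
  open Field K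

  Chain : Set c
  Chain = Face n → Carrier

  facet : Face n → Face n → Bool
  facet G H = (G ⊆ᵇ H) ∧ (∣ H ∣ ≡ᵇ suc ∣ G ∣)

  ∂ : Cx n → Chain → Chain
  ∂ Δ x G = foldr _+_ 0#
    (map (λ H → if Δ H ∧ facet G H
                  then (if signOdd H G then - (x H) else x H)
                  else 0#)
         (allSubsets n))

  IsCycle : Cx n → ℕ → Chain → Set ℓ
  IsCycle Δ s x = ∀ G → Δ G ≡ true → suc ∣ G ∣ ≡ s → ∂ Δ x G ≈ 0#

  IsBoundary : Cx n → ℕ → Chain → Set (c ⊔ ℓ)
  IsBoundary Δ s x = ∃ λ y → ∀ G → Δ G ≡ true → ∣ G ∣ ≡ s → x G ≈ ∂ Δ y G

  HZero : Cx n → ℕ → Set (c ⊔ ℓ)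
  HZero Δ s = ∀ x → IsCycle Δ s x → IsBoundary Δ s x

  HOne : Cx n → ℕ → Set (c ⊔ ℓ)
  HOne Δ s = ∃ λ z → IsCycle Δ s z × ¬ IsBoundary Δ s z
           × (∀ x → IsCycle Δ s x → ∃ λ a → IsBoundary Δ s (λ G → x G - a * z G))

  IsHomologySphere : Cx n → ℕ → Set (c ⊔ ℓ)
  IsHomologySphere Δ d = IsComplex Δ × HasSize Δ d
    × (∀ F → Δ F ≡ true → ∀ e → HasSize (link Δ F) e → ∀ s →
         (s ≡ e → HOne (link Δ F) s) × (s ≢ e → HZero (link Δ F) s))

  -- boundary condition: ∂Δ is a (d-2)-dimensional homology sphere
  -- (for d = 0, i.e. dim Δ = -1, ∂Δ is the void complex)
  BoundarySphere : Cx n → ℕ → Set (c ⊔ ℓ)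
  BoundarySphere B zero    = Level.Lift (c ⊔ ℓ) (∀ G → B G ≡ false)
  BoundarySphere B (suc e) = IsHomologySphere B e

  IsHomologyBallWith : Cx n → Cx n → ℕ → Set (c ⊔ ℓ)
  IsHomologyBallWith Δ B d = IsComplex Δ × HasSize Δ d
    × IsComplex B × B ⊑ Δ × BoundarySphere B d
    × (∀ F → Δ F ≡ true → ∀ e → HasSize (link Δ F) e → ∀ s →
         (B F ≡ false → s ≡ e → HOne (link Δ F) s)
       × ((B F ≡ true ⊎ s ≢ e) → HZero (link Δ F) s))

module _ {n : ℕ} where

  restr : Cx n → (Face n → Face n) → Face n → Cx n
  restr Δ' σ F E = Δ' E ∧ (σ E ⊆ᵇ F)

  -- boundary of Δ'_F: complement of the interior σ⁻¹(F) in Δ'_F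
  restrBd : Cx n → (Face n → Face n) → Face n → Cx n
  restrBd Δ' σ F E = restr Δ' σ F E ∧ not (σ E ==ᵇ F)

  IsHomologySubdivision : ∀ {c ℓ} → Field c ℓ →
    Cx n → Cx n → (Face n → Face n) → Set (c ⊔ ℓ)
  IsHomologySubdivision K Δ' Δ σ =
    IsComplex Δ' × IsComplex Δ
    × (∀ E → Δ' E ≡ true → Δ (σ E) ≡ true)
    × (∀ F → Δ F ≡ true →
         IsComplex (restr Δ' σ F)
         × Homology.IsHomologyBallWith K (restr Δ' σ F) (restrBd Δ' σ F) ∣ F ∣)

  IsVertexInduced : Cx n → Cx n → (Face n → Face n) → Set
  IsVertexInduced Δ' Δ σ = ∀ E F → Δ' E ≡ true → Δ F ≡ true →
    (∀ v → v ∈ E → restr Δ' σ F ⁅ v ⁆ ≡ true) → restr Δ' σ F E ≡ true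

  IsFlagSubdivision : Cx n → Cx n → (Face n → Face n) → Set
  IsFlagSubdivision Δ' Δ σ = ∀ F → Δ F ≡ true → IsFlag (restr Δ' σ F)

  -- σ : Δ'₁ * Δ'₂ → Δ₁ * Δ₂,  σ(E₁ ∪ E₂) = σ₁(E₁) ∪ σ₂(E₂),
  -- where E₁ = E ∩ V(Δ'₁), E₂ = E ∩ V(Δ'₂)
  joinMap : Cx n → Cx n → (Face n → Face n) → (Face n → Face n) → Face n → Face n
  joinMap Δ'₁ Δ'₂ σ₁ σ₂ E = σ₁ (E ∩ vertices Δ'₁) ∪ σ₂ (E ∩ vertices Δ'₂)

  linkMap : (Face n → Face n) → Face n → Face n → Face n
  linkMap σ F E = σ (E ∪ F) ─ F

{-# OPTIONS --safe #-}
-- Both subdivisions restrict well: over a face F₁ ∪ F₂ of Δ₁ * Δ₂ the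
-- restriction of the join map is the join of the restrictions of σ₁ to F₁ and
-- σ₂ to F₂, and over a face H of link Δ F the restriction of σ_F is the link
-- of F in the restriction of σ to H ∪ F.  Vertex-inducedness passes through
-- these identities directly.  For flagness it remains to see that joins and
-- links of flag complexes are flag: a minimal non-face of a join meets one
-- side in a non-face and is then a minimal non-face of that side; a minimal
-- non-face G of a link with more than two vertices would make G ∪ F a clique,
-- hence a face, of the flag complex.
module Submission where

open import Defs
open import Level using (Level)
open import Data.Nat using (ℕ; zero; suc; _≤_; _<_; s≤s; z≤n; _≟_; _≤?_)
open import Data.Nat.Properties
  using (≤-refl; ≤-reflexive; ≤-trans; ≤-pred; ≤-<-trans; <-≤-trans; n≮0; <⇒≱; ≰⇒>; ≤∧≢⇒<)
open import Data.Bool using (true; false; _∧_)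
open import Data.Bool.Properties using (∧-assoc; not-¬; T-≡)
open import Data.Vec using ([]; _∷_)
open import Data.Vec.Base using (here; there)
open import Data.Vec.Properties using (lookup∘tabulate; []=⇒lookup; lookup⇒[]=; tabulate-cong)
open import Data.Fin using (Fin; zero; suc)
open import Data.Fin.Subset using (Subset; ⁅_⁆; _∈_; _∉_; _∩_; _∪_; _─_; ∣_∣; ⊥; _⊆_; _⊂_; _⊄_)
open import Data.Fin.Subset.Properties
open import Data.List using (List; map)
import Data.List.Relation.Unary.Any as List
open import Data.List.Relation.Unary.Any.Properties using (any⁺; any⁻)
open import Data.List.Membership.Propositional using (lose) renaming (_∈_ to _∈ₗ_)
open import Data.List.Membership.Propositional.Properties using (∈-++⁺ˡ; ∈-++⁺ʳ; ∈-map⁺)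
open import Data.Bool.ListAction using (any)
open import Data.Empty using (⊥-elim)
open import Data.Product using (∃; _×_; _,_; proj₁; proj₂)
open import Data.Sum using (_⊎_; inj₁; inj₂)
open import Function using (_∘_; Equivalence)
open import Relation.Nullary using (contradiction; yes; no)
open import Relation.Binary.PropositionalEquality

private variable
  n : ℕ
  x : Fin n
  p q r : Subset n
  A A' B B' Δ Δ' : Cx n
  E F G H X Y : Face n
  σ : Face n → Face n

∧-true⁻ : ∀ {a b} → a ∧ b ≡ true → a ≡ true × b ≡ true
∧-true⁻ {true} b≡true = refl , b≡true

∧-true⁺ : ∀ {a b} → a ≡ true → b ≡ true → a ∧ b ≡ true
∧-true⁺ refl b≡true = b≡true

≡-true-ext : ∀ {a b} → (a ≡ true → b ≡ true) → (b ≡ true → a ≡ true) → a ≡ b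
≡-true-ext {false} {false} _   _   = refl
≡-true-ext {false} {true}  _   b⇒a = b⇒a refl
≡-true-ext {true}          a⇒b _   = sym (a⇒b refl)

⊆ᵇ⇒⊆ : p ⊆ᵇ q ≡ true → p ⊆ q
⊆ᵇ⇒⊆ {p = true ∷ _}  {true ∷ _} _ here        = here
⊆ᵇ⇒⊆ {p = true ∷ _}  {true ∷ _} e (there x∈p) = there (⊆ᵇ⇒⊆ e x∈p)
⊆ᵇ⇒⊆ {p = false ∷ _} {_ ∷ _}    e (there x∈p) = there (⊆ᵇ⇒⊆ e x∈p)

⊆⇒⊆ᵇ : p ⊆ q → p ⊆ᵇ q ≡ true
⊆⇒⊆ᵇ {p = []}        {[]}        _   = refl
⊆⇒⊆ᵇ {p = true ∷ _}  {false ∷ _} p⊆q with () ← p⊆q here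
⊆⇒⊆ᵇ {p = true ∷ _}  {true ∷ _}  p⊆q = ⊆⇒⊆ᵇ (drop-∷-⊆ p⊆q)
⊆⇒⊆ᵇ {p = false ∷ _} {_ ∷ _}     p⊆q = ⊆⇒⊆ᵇ (drop-∷-⊆ p⊆q)

==ᵇ⇒≡ : p ==ᵇ q ≡ true → p ≡ q
==ᵇ⇒≡ {p = []}        {[]}        _ = refl
==ᵇ⇒≡ {p = true ∷ _}  {true ∷ _}  e = cong (true ∷_) (==ᵇ⇒≡ e)
==ᵇ⇒≡ {p = false ∷ _} {false ∷ _} e = cong (false ∷_) (==ᵇ⇒≡ e)

==ᵇ-refl : (p : Subset n) → p ==ᵇ p ≡ true
==ᵇ-refl []          = refl
==ᵇ-refl (true ∷ p)  = ==ᵇ-refl p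
==ᵇ-refl (false ∷ p) = ==ᵇ-refl p

─-⊆ᵇ : (p q r : Subset n) → (p ─ r) ⊆ᵇ q ≡ p ⊆ᵇ (q ∪ r)
─-⊆ᵇ []          []          []          = refl
─-⊆ᵇ (true ∷ p)  (true ∷ q)  (true ∷ r)  = ─-⊆ᵇ p q r
─-⊆ᵇ (true ∷ p)  (true ∷ q)  (false ∷ r) = ─-⊆ᵇ p q r
─-⊆ᵇ (true ∷ p)  (false ∷ q) (true ∷ r)  = ─-⊆ᵇ p q r
─-⊆ᵇ (true ∷ p)  (false ∷ q) (false ∷ r) = refl
─-⊆ᵇ (false ∷ p) (true ∷ q)  (true ∷ r)  = ─-⊆ᵇ p q r
─-⊆ᵇ (false ∷ p) (true ∷ q)  (false ∷ r) = ─-⊆ᵇ p q r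
─-⊆ᵇ (false ∷ p) (false ∷ q) (true ∷ r)  = ─-⊆ᵇ p q r
─-⊆ᵇ (false ∷ p) (false ∷ q) (false ∷ r) = ─-⊆ᵇ p q r

any-true⁺ : ∀ {I : Set} {f} {i : I} {is} → i ∈ₗ is → f i ≡ true → any f is ≡ true
any-true⁺ {f = f} i∈is fi = Equivalence.to T-≡ (any⁺ f (lose i∈is (Equivalence.from T-≡ fi)))

any-true⁻ : ∀ {I : Set} {f} (is : List I) → any f is ≡ true → ∃ λ i → f i ≡ true
any-true⁻ {f = f} is e with List.satisfied (any⁻ f is (Equivalence.from T-≡ e))
... | i , fi = i , Equivalence.to T-≡ fi

∈-allSubsets : (p : Subset n) → p ∈ₗ allSubsets n
∈-allSubsets []          = List.here refl
∈-allSubsets (false ∷ p) = ∈-++⁺ˡ (∈-map⁺ (false ∷_) (∈-allSubsets p))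
∈-allSubsets (true ∷ p)  =
  ∈-++⁺ʳ (map (false ∷_) (allSubsets _)) (∈-map⁺ (true ∷_) (∈-allSubsets p))

⁅⁆⊆ : x ∈ p → ⁅ x ⁆ ⊆ p
⁅⁆⊆ x∈p y∈⁅x⁆ rewrite x∈⁅y⁆⇒x≡y _ y∈⁅x⁆ = x∈p

∪-lub : p ⊆ r → q ⊆ r → p ∪ q ⊆ r
∪-lub {p = p} {q = q} p⊆r q⊆r x∈p∪q with x∈p∪q⁻ p q x∈p∪q
... | inj₁ x∈p = p⊆r x∈p
... | inj₂ x∈q = q⊆r x∈q

⊆-∪-cancelʳ : p ⊆ q ∪ r → (∀ {x} → x ∈ p → x ∉ r) → p ⊆ q
⊆-∪-cancelʳ {q = q} {r = r} p⊆q∪r p∩r≡∅ x∈p with x∈p∪q⁻ q r (p⊆q∪r x∈p)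
... | inj₁ x∈q = x∈q
... | inj₂ x∈r = contradiction x∈r (p∩r≡∅ x∈p)

⊆-∪-cancelˡ : p ⊆ q ∪ r → (∀ {x} → x ∈ p → x ∉ q) → p ⊆ r
⊆-∪-cancelˡ {q = q} {r = r} p⊆q∪r = ⊆-∪-cancelʳ (subst (_ ⊆_) (∪-comm q r) p⊆q∪r)

⊆⇒∩≡ : p ⊆ q → p ∩ q ≡ p
⊆⇒∩≡ {p = p} {q = q} p⊆q = ⊆-antisym (p∩q⊆p p q) (λ x∈p → x∈p∩q⁺ (x∈p , p⊆q x∈p))

disjoint⇒∩≡⊥ : (∀ {x} → x ∈ p → x ∉ q) → p ∩ q ≡ ⊥
disjoint⇒∩≡⊥ {p = p} {q = q} p∩q≡∅ =
  Empty-unique λ (x , x∈p∩q) → p∩q≡∅ (proj₁ (x∈p∩q⁻ p q x∈p∩q)) (proj₂ (x∈p∩q⁻ p q x∈p∩q))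

∪-∩-cancel : p ⊆ r → (∀ {x} → x ∈ q → x ∉ r) → (p ∪ q) ∩ r ≡ p
∪-∩-cancel {p = p} {r = r} {q = q} p⊆r q∩r≡∅ = begin
  (p ∪ q) ∩ r      ≡⟨ ∩-distribʳ-∪ r p q ⟩
  p ∩ r ∪ q ∩ r    ≡⟨ cong₂ _∪_ (⊆⇒∩≡ p⊆r) (disjoint⇒∩≡⊥ q∩r≡∅) ⟩
  p ∪ ⊥            ≡⟨ ∪-identityʳ p ⟩
  p                ∎
  where open ≡-Reasoning

∩-∪-recompose : p ⊆ q ∪ r → p ∩ q ∪ p ∩ r ≡ p
∩-∪-recompose {p = p} {q = q} {r = r} p⊆q∪r = trans (sym (∩-distribˡ-∪ p q r)) (⊆⇒∩≡ p⊆q∪r)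

p⊆q∧p⊄q⇒q⊆p : p ⊆ q → p ⊄ q → q ⊆ p
p⊆q∧p⊄q⇒q⊆p {p = p} p⊆q p⊄q {x} x∈q with x ∈? p
... | yes x∈p = x∈p
... | no  x∉p = contradiction ((λ {y} → p⊆q {y}) , x , x∈q , x∉p) p⊄q

∣p∣<∣q∣⇒p⊂q : p ⊆ q → ∣ p ∣ < ∣ q ∣ → p ⊂ q
∣p∣<∣q∣⇒p⊂q {p = p} {q = q} p⊆q ∣p∣<∣q∣ with p ⊂? q
... | yes p⊂q = p⊂q
... | no  p⊄q = contradiction (p⊆q⇒∣p∣≤∣q∣ (p⊆q∧p⊄q⇒q⊆p p⊆q p⊄q)) (<⇒≱ ∣p∣<∣q∣)

∣p∣≤0⇒p≡⊥ : ∣ p ∣ ≤ 0 → p ≡ ⊥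
∣p∣≤0⇒p≡⊥ ∣p∣≤0 = Empty-unique λ (_ , x∈p) → n≮0 (<-≤-trans (x∈p⇒∣p-x∣<∣p∣ x∈p) ∣p∣≤0)

∣p∣≤1⇒p≡⊥⊎⁅x⁆ : (p : Subset n) → ∣ p ∣ ≤ 1 → p ≡ ⊥ ⊎ ∃ λ x → p ≡ ⁅ x ⁆
∣p∣≤1⇒p≡⊥⊎⁅x⁆ []          _ = inj₁ refl
∣p∣≤1⇒p≡⊥⊎⁅x⁆ (true ∷ p)  (s≤s ∣p∣≤0) = inj₂ (zero , cong (true ∷_) (∣p∣≤0⇒p≡⊥ ∣p∣≤0))
∣p∣≤1⇒p≡⊥⊎⁅x⁆ (false ∷ p) ∣p∣≤1 with ∣p∣≤1⇒p≡⊥⊎⁅x⁆ p ∣p∣≤1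
... | inj₁ p≡⊥       = inj₁ (cong (false ∷_) p≡⊥)
... | inj₂ (x , p≡⁅x⁆) = inj₂ (suc x , cong (false ∷_) p≡⁅x⁆)

∈-vertices⁺ : ∀ Δ → Δ ⁅ x ⁆ ≡ true → x ∈ vertices Δ
∈-vertices⁺ {x = x} Δ Δx = lookup⇒[]= x _ (trans (lookup∘tabulate (λ i → Δ ⁅ i ⁆) x) Δx)

∈-vertices⁻ : ∀ Δ → x ∈ vertices Δ → Δ ⁅ x ⁆ ≡ true
∈-vertices⁻ {x = x} Δ x∈V = trans (sym (lookup∘tabulate (λ i → Δ ⁅ i ⁆) x)) ([]=⇒lookup x∈V)

face⊆vertices : IsComplex Δ → Δ G ≡ true → G ⊆ vertices Δ
face⊆vertices {Δ = Δ} complex ΔG x∈G = ∈-vertices⁺ Δ (complex _ _ (⁅⁆⊆ x∈G) ΔG)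

vertices-mono : A ⊑ B → vertices A ⊆ vertices B
vertices-mono {A = A} {B = B} A⊑B x∈VA = ∈-vertices⁺ B (A⊑B _ (∈-vertices⁻ A x∈VA))

disjoint⇒∉ : DisjointVertices A B → x ∈ vertices A → x ∉ vertices B
disjoint⇒∉ disjoint x∈VA x∈VB =
  ∉⊥ (subst (_ ∈_) disjoint (x∈p∩q⁺ (x∈VA , x∈VB)))

disjoint-mono : A ⊑ A' → B ⊑ B' → DisjointVertices A' B' → DisjointVertices A B
disjoint-mono {A' = A'} {B' = B'} A⊑A' B⊑B' disjoint =
  disjoint⇒∩≡⊥ λ x∈VA x∈VB →
    disjoint⇒∉ {A = A'} {B = B'} disjoint (vertices-mono A⊑A' x∈VA) (vertices-mono B⊑B' x∈VB)

small-face : Δ ⊥ ≡ true → G ⊆ vertices Δ → ∣ G ∣ ≤ 1 → Δ G ≡ true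
small-face {Δ = Δ} {G = G} Δ∅ G⊆V ∣G∣≤1 with ∣p∣≤1⇒p≡⊥⊎⁅x⁆ G ∣G∣≤1
... | inj₁ refl       = Δ∅
... | inj₂ (x , refl) = ∈-vertices⁻ Δ (G⊆V (x∈⁅x⁆ x))

IsMinimalNonFace : Cx n → Face n → Set
IsMinimalNonFace Δ G = G ⊆ vertices Δ × Δ G ≡ false × (∀ H → H ⊂ G → Δ H ≡ true)

flag⇒∣minimalNonFace∣≡2 : IsFlag Δ → IsMinimalNonFace Δ G → ∣ G ∣ ≡ 2
flag⇒∣minimalNonFace∣≡2 flag (G⊆V , ΔG≡false , minimal) = flag _ G⊆V ΔG≡false minimal

IsFlag-resp-≗ : A ≗ B → IsFlag B → IsFlag A
IsFlag-resp-≗ {A = A} {B = B} A≗B flagB G G⊆VA AG≡false minimal =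
  flagB G (subst (G ⊆_) (tabulate-cong (λ i → A≗B ⁅ i ⁆)) G⊆VA)
    (trans (sym (A≗B G)) AG≡false) (λ H H⊂G → trans (sym (A≗B H)) (minimal H H⊂G))

minimalNonFace-restrict : {J R : Cx n} {V : Subset n} →
  (∀ H → H ⊆ V → J H ≡ true → R H ≡ true) →
  IsMinimalNonFace J G → R (G ∩ V) ≡ false → IsMinimalNonFace R G
minimalNonFace-restrict {G = G} {J = J} {R = R} {V = V}
  J⇒R (G⊆VJ , JG≡false , minimal) RG∩V≡false with G ∩ V ⊂? G
... | yes G∩V⊂G = ⊥-elim (not-¬ (J⇒R (G ∩ V) (p∩q⊆q G V) (minimal (G ∩ V) G∩V⊂G)) RG∩V≡false)
... | no  G∩V⊄G =
  (λ x∈G → ∈-vertices⁺ R (J⇒R _ (⊆-trans (⁅⁆⊆ x∈G) G⊆V) (∈-vertices⁻ J (G⊆VJ x∈G))))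
  , subst (λ S → R S ≡ false) (⊆⇒∩≡ G⊆V) RG∩V≡false
  , λ H H⊂G → J⇒R H (⊆-trans (p⊂q⇒p⊆q H⊂G) G⊆V) (minimal H H⊂G)
  where
  G⊆V : G ⊆ V
  G⊆V x∈G = p∩q⊆q G V (p⊆q∧p⊄q⇒q⊆p (p∩q⊆p G V) G∩V⊄G x∈G)

flag⇒cliqueFace : IsFlag Δ → G ⊆ vertices Δ →
  (∀ T → T ⊆ G → ∣ T ∣ ≤ 2 → Δ T ≡ true) → Δ G ≡ true
flag⇒cliqueFace {Δ = Δ} {G = G} flag = go ∣ G ∣ ≤-refl
  where
  go : ∀ k {S} → ∣ S ∣ ≤ k → S ⊆ vertices Δ →
    (∀ T → T ⊆ S → ∣ T ∣ ≤ 2 → Δ T ≡ true) → Δ S ≡ true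
  go k {S} ∣S∣≤k S⊆V edges with Δ S in ΔS | ∣ S ∣ ≤? 2
  ... | true  | _         = refl
  ... | false | yes ∣S∣≤2 = trans (sym ΔS) (edges S ⊆-refl ∣S∣≤2)
  go zero    ∣S∣≤0 _ _ | false | no ∣S∣≰2 = contradiction (≤-trans ∣S∣≤0 z≤n) ∣S∣≰2
  go (suc k) ∣S∣≤k S⊆V edges | false | no ∣S∣≰2 =
    contradiction (flag _ S⊆V ΔS (λ T T⊂S → go k (≤-pred (≤-trans (p⊂q⇒∣p∣<∣q∣ T⊂S) ∣S∣≤k))
                                      (⊆-trans (p⊂q⇒p⊆q T⊂S) S⊆V)
                                      (λ U U⊆T → edges U (⊆-trans U⊆T (p⊂q⇒p⊆q T⊂S)))))
                  (∣S∣≰2 ∘ ≤-reflexive)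

join⁺ : A X ≡ true → B Y ≡ true → join A B (X ∪ Y) ≡ true
join⁺ {X = X} {Y = Y} AX BY =
  any-true⁺ (∈-allSubsets X)
    (any-true⁺ (∈-allSubsets Y) (∧-true⁺ AX (∧-true⁺ BY (==ᵇ-refl (X ∪ Y)))))

join⁻ : join A B E ≡ true → ∃ λ X → ∃ λ Y → A X ≡ true × B Y ≡ true × X ∪ Y ≡ E
join⁻ {A = A} J with any-true⁻ (allSubsets _) J
... | X , J′ with any-true⁻ (allSubsets _) J′
... | Y , AX∧BY∧X∪Y≡E with ∧-true⁻ {A X} AX∧BY∧X∪Y≡E
... | AX , BY∧X∪Y≡E with ∧-true⁻ BY∧X∪Y≡E
... | BY , X∪Y≡E = X , Y , AX , BY , ==ᵇ⇒≡ X∪Y≡E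

vertices-join : IsComplex A → IsComplex B → vertices (join A B) ⊆ vertices A ∪ vertices B
vertices-join {A = A} {B = B} complexA complexB {x} x∈VJ
  with join⁻ {A = A} {B = B} (∈-vertices⁻ (join A B) x∈VJ)
... | X , Y , AX , BY , X∪Y≡⁅x⁆ with x∈p∪q⁻ X Y (subst (x ∈_) (sym X∪Y≡⁅x⁆) (x∈⁅x⁆ x))
... | inj₁ x∈X = x∈p∪q⁺ (inj₁ (face⊆vertices complexA AX x∈X))
... | inj₂ x∈Y = x∈p∪q⁺ (inj₂ (face⊆vertices complexB BY x∈Y))

join-∩-vertices : IsComplex A → IsComplex B → DisjointVertices A B → A X ≡ true → B Y ≡ true →
  (X ∪ Y) ∩ vertices A ≡ X × (X ∪ Y) ∩ vertices B ≡ Y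
join-∩-vertices {A = A} {B = B} {X = X} {Y = Y} complexA complexB disjoint AX BY =
  ∪-∩-cancel X⊆VA (λ x∈Y x∈VA → disjoint⇒∉ {A = A} {B = B} disjoint x∈VA (Y⊆VB x∈Y))
  , trans (cong (_∩ vertices B) (∪-comm X Y))
      (∪-∩-cancel Y⊆VB (λ x∈X → disjoint⇒∉ {A = A} {B = B} disjoint (X⊆VA x∈X)))
  where
  X⊆VA : X ⊆ vertices A
  X⊆VA = face⊆vertices complexA AX

  Y⊆VB : Y ⊆ vertices B
  Y⊆VB = face⊆vertices complexB BY

join-split : IsComplex A → IsComplex B → DisjointVertices A B → join A B E ≡ true →
  A (E ∩ vertices A) ≡ true × B (E ∩ vertices B) ≡ true × E ∩ vertices A ∪ E ∩ vertices B ≡ E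
join-split {A = A} {B = B} complexA complexB disjoint J with join⁻ {A = A} {B = B} J
... | X , Y , AX , BY , refl with join-∩-vertices complexA complexB disjoint AX BY
... | E∩VA≡X , E∩VB≡Y =
  subst (λ S → A S ≡ true) (sym E∩VA≡X) AX
  , subst (λ S → B S ≡ true) (sym E∩VB≡Y) BY
  , cong₂ _∪_ E∩VA≡X E∩VB≡Y

join-faceˡ : IsComplex A → IsComplex B → join A B H ≡ true →
  (∀ {x} → x ∈ H → x ∉ vertices B) → A H ≡ true
join-faceˡ {A = A} {B = B} complexA complexB J H∩VB≡∅ with join⁻ {A = A} {B = B} J
... | X , Y , AX , BY , refl =
  complexA X (X ∪ Y) (⊆-∪-cancelʳ ⊆-refl λ x∈X∪Y x∈Y → H∩VB≡∅ x∈X∪Y (face⊆vertices complexB BY x∈Y)) AX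

join-faceʳ : IsComplex A → IsComplex B → join A B H ≡ true →
  (∀ {x} → x ∈ H → x ∉ vertices A) → B H ≡ true
join-faceʳ {A = A} {B = B} complexA complexB J H∩VA≡∅ with join⁻ {A = A} {B = B} J
... | X , Y , AX , BY , refl =
  complexB Y (X ∪ Y) (⊆-∪-cancelˡ ⊆-refl λ x∈X∪Y x∈X → H∩VA≡∅ x∈X∪Y (face⊆vertices complexA AX x∈X)) BY

join-isFlag : IsComplex A → IsComplex B → DisjointVertices A B →
  IsFlag A → IsFlag B → IsFlag (join A B)
join-isFlag {A = A} {B = B} complexA complexB disjoint flagA flagB G G⊆VJ JG≡false minimal
  with A (G ∩ vertices A) in AG₁ | B (G ∩ vertices B) in BG₂
... | false | _ =
  flag⇒∣minimalNonFace∣≡2 flagA (minimalNonFace-restrict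
    (λ H H⊆VA JH → join-faceˡ complexA complexB JH (disjoint⇒∉ {A = A} {B = B} disjoint ∘ H⊆VA))
    (G⊆VJ , JG≡false , minimal) AG₁)
... | true | false =
  flag⇒∣minimalNonFace∣≡2 flagB (minimalNonFace-restrict
    (λ H H⊆VB JH → join-faceʳ complexA complexB JH λ x∈H x∈VA →
       disjoint⇒∉ {A = A} {B = B} disjoint x∈VA (H⊆VB x∈H))
    (G⊆VJ , JG≡false , minimal) BG₂)
... | true | true = ⊥-elim (not-¬ JG≡true JG≡false)
  where
  JG≡true : join A B G ≡ true
  JG≡true = subst (λ S → join A B S ≡ true)
    (∩-∪-recompose (⊆-trans G⊆VJ (vertices-join complexA complexB))) (join⁺ {A = A} {B = B} AG₁ BG₂)

link-face⁻ : link Δ F E ≡ true → E ∩ F ≡ ⊥ × Δ (E ∪ F) ≡ true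
link-face⁻ {F = F} {E = E} L with ∧-true⁻ {(E ∩ F) ==ᵇ ⊥} L
... | E∩F≡⊥ , ΔE∪F = ==ᵇ⇒≡ E∩F≡⊥ , ΔE∪F

link-face⁺ : E ∩ F ≡ ⊥ → Δ (E ∪ F) ≡ true → link Δ F E ≡ true
link-face⁺ {E = E} {F = F} E∩F≡⊥ ΔE∪F =
  ∧-true⁺ (subst (λ S → ((E ∩ F) ==ᵇ S) ≡ true) E∩F≡⊥ (==ᵇ-refl (E ∩ F))) ΔE∪F

link-isFlag : IsComplex Δ → IsFlag Δ → Δ F ≡ true → IsFlag (link Δ F)
link-isFlag {Δ = Δ} {F = F} complex flag ΔF G G⊆VL LG≡false minimal with ∣ G ∣ ≟ 2
... | yes ∣G∣≡2 = ∣G∣≡2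
... | no  ∣G∣≢2 = ⊥-elim (not-¬ LG≡true LG≡false)
  where
  vertex⁻ : x ∈ G → x ∉ F × Δ (⁅ x ⁆ ∪ F) ≡ true
  vertex⁻ {x = x} x∈G with link-face⁻ {Δ = Δ} (∈-vertices⁻ (link Δ F) (G⊆VL x∈G))
  ... | ⁅x⁆∩F≡⊥ , Δx∪F = (λ x∈F → ∉⊥ (subst (x ∈_) ⁅x⁆∩F≡⊥ (x∈p∩q⁺ (x∈⁅x⁆ x , x∈F)))) , Δx∪F

  G∪F⊆V : G ∪ F ⊆ vertices Δ
  G∪F⊆V = ∪-lub (λ {x} x∈G → face⊆vertices complex (proj₂ (vertex⁻ x∈G)) (p⊆p∪q F (x∈⁅x⁆ x)))
                (face⊆vertices complex ΔF)

  L∅ : link Δ F ⊥ ≡ true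
  L∅ = link-face⁺ {Δ = Δ} (∩-zeroˡ F) (subst (λ S → Δ S ≡ true) (sym (∪-identityˡ F)) ΔF)

  LG≡true : link Δ F G ≡ true
  LG≡true with ∣ G ∣ ≤? 1
  ... | yes ∣G∣≤1 = small-face L∅ G⊆VL ∣G∣≤1
  ... | no  ∣G∣≰1 =
    link-face⁺ {Δ = Δ} (disjoint⇒∩≡⊥ (proj₁ ∘ vertex⁻)) (flag⇒cliqueFace flag G∪F⊆V edge)
    where
    2<∣G∣ : 2 < ∣ G ∣
    2<∣G∣ = ≤∧≢⇒< (≰⇒> ∣G∣≰1) (∣G∣≢2 ∘ sym)

    -- an edge T of G ∪ F meets G in a proper subset, which lies in the link
    edge : ∀ T → T ⊆ G ∪ F → ∣ T ∣ ≤ 2 → Δ T ≡ true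
    edge T T⊆G∪F ∣T∣≤2 =
      complex (T ∩ G ∪ F) T T⊆T∩G∪F (proj₂ (link-face⁻ {Δ = Δ} (minimal (T ∩ G) T∩G⊂G)))
      where
      T∩G⊂G : T ∩ G ⊂ G
      T∩G⊂G = ∣p∣<∣q∣⇒p⊂q (p∩q⊆q T G) (≤-<-trans (≤-trans (∣p∩q∣≤∣p∣ T G) ∣T∣≤2) 2<∣G∣)
      T⊆T∩G∪F : T ⊆ T ∩ G ∪ F
      T⊆T∩G∪F x∈T with x∈p∪q⁻ G F (T⊆G∪F x∈T)
      ... | inj₁ x∈G = p⊆p∪q F (x∈p∩q⁺ (x∈T , x∈G))
      ... | inj₂ x∈F = q⊆p∪q (T ∩ G) F x∈F

record IsFaceSubdivision (Δ' Δ : Cx n) (σ : Face n → Face n) : Set where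
  field
    source-complex : IsComplex Δ'
    target-complex : IsComplex Δ
    face↦face      : ∀ E → Δ' E ≡ true → Δ (σ E) ≡ true
    restr-complex  : ∀ F → Δ F ≡ true → IsComplex (restr Δ' σ F)

homology⇒faceSubdivision : ∀ {c ℓ} (K : Field c ℓ) →
  IsHomologySubdivision K Δ' Δ σ → IsFaceSubdivision Δ' Δ σ
homology⇒faceSubdivision K (complex' , complex , face↦face , restrictions) = record
  { source-complex = complex'
  ; target-complex = complex
  ; face↦face      = face↦face
  ; restr-complex  = λ F ΔF → proj₁ (restrictions F ΔF)
  }

restr⊑ : ∀ Δ' σ (F : Face n) → restr Δ' σ F ⊑ Δ'
restr⊑ Δ' σ F E R = proj₁ (∧-true⁻ {Δ' E} R)

restr-fixedFace : Δ' F ≡ true → σ F ≡ F → F ⊆ H → restr Δ' σ H F ≡ true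
restr-fixedFace {F = F} {σ = σ} {H = H} Δ'F σF≡F F⊆H =
  ∧-true⁺ Δ'F (⊆⇒⊆ᵇ (subst (_⊆ H) (sym σF≡F) F⊆H))

restr-linkMap : ∀ (Δ' : Cx n) σ F H →
  restr (link Δ' F) (linkMap σ F) H ≗ link (restr Δ' σ (H ∪ F)) F
restr-linkMap Δ' σ F H E = begin
  (((E ∩ F) ==ᵇ ⊥) ∧ Δ' (E ∪ F)) ∧ ((σ (E ∪ F) ─ F) ⊆ᵇ H)
    ≡⟨ ∧-assoc ((E ∩ F) ==ᵇ ⊥) (Δ' (E ∪ F)) _ ⟩
  ((E ∩ F) ==ᵇ ⊥) ∧ Δ' (E ∪ F) ∧ ((σ (E ∪ F) ─ F) ⊆ᵇ H)
    ≡⟨ cong (λ b → ((E ∩ F) ==ᵇ ⊥) ∧ Δ' (E ∪ F) ∧ b) (─-⊆ᵇ (σ (E ∪ F)) H F) ⟩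
  ((E ∩ F) ==ᵇ ⊥) ∧ Δ' (E ∪ F) ∧ (σ (E ∪ F) ⊆ᵇ (H ∪ F))
    ∎
  where open ≡-Reasoning

linkMap-vertexInduced : IsFaceSubdivision Δ' Δ σ → Δ' F ≡ true → σ F ≡ F →
  IsVertexInduced Δ' Δ σ → IsVertexInduced (link Δ' F) (link Δ F) (linkMap σ F)
linkMap-vertexInduced {Δ' = Δ'} {Δ = Δ} {σ = σ} {F = F} S Δ'F σF≡F vertexInduced
  E G E∈L G∈L vertices-in =
  trans (restr-linkMap Δ' σ F G E)
    (link-face⁺ {Δ = R} (proj₁ (link-face⁻ {Δ = Δ'} E∈L))
      (vertexInduced (E ∪ F) (G ∪ F) (proj₂ (link-face⁻ {Δ = Δ'} E∈L)) ΔG∪F vertices-in′))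
  where
  open IsFaceSubdivision S
  R : Cx _
  R = restr Δ' σ (G ∪ F)

  ΔG∪F : Δ (G ∪ F) ≡ true
  ΔG∪F = proj₂ (link-face⁻ {Δ = Δ} G∈L)

  vertices-in′ : ∀ w → w ∈ E ∪ F → R ⁅ w ⁆ ≡ true
  vertices-in′ w w∈E∪F with x∈p∪q⁻ E F w∈E∪F
  ... | inj₁ w∈E = restr-complex (G ∪ F) ΔG∪F (⁅ w ⁆ ∪ F) ⁅ w ⁆ (p⊆p∪q F)
        (proj₂ (link-face⁻ {Δ = R} (trans (sym (restr-linkMap Δ' σ F G ⁅ w ⁆)) (vertices-in w w∈E))))
  ... | inj₂ w∈F = restr-complex (G ∪ F) ΔG∪F F ⁅ w ⁆ (⁅⁆⊆ w∈F)
        (restr-fixedFace {Δ' = Δ'} {σ = σ} Δ'F σF≡F (q⊆p∪q G F))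

linkMap-flag : IsFaceSubdivision Δ' Δ σ → Δ' F ≡ true → σ F ≡ F →
  IsFlagSubdivision Δ' Δ σ → IsFlagSubdivision (link Δ' F) (link Δ F) (linkMap σ F)
linkMap-flag {Δ' = Δ'} {Δ = Δ} {σ = σ} {F = F} S Δ'F σF≡F flag H H∈L =
  IsFlag-resp-≗ (restr-linkMap Δ' σ F H)
    (link-isFlag (restr-complex (H ∪ F) ΔH∪F) (flag (H ∪ F) ΔH∪F)
      (restr-fixedFace {Δ' = Δ'} {σ = σ} Δ'F σF≡F (q⊆p∪q H F)))
  where
  open IsFaceSubdivision S
  ΔH∪F : Δ (H ∪ F) ≡ true
  ΔH∪F = proj₂ (link-face⁻ {Δ = Δ} H∈L)

module JoinMap {Δ₁ Δ₂ Δ'₁ Δ'₂ : Cx n} {σ₁ σ₂ : Face n → Face n}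
  (S₁ : IsFaceSubdivision Δ'₁ Δ₁ σ₁) (S₂ : IsFaceSubdivision Δ'₂ Δ₂ σ₂)
  (disjoint : DisjointVertices Δ₁ Δ₂) (disjoint' : DisjointVertices Δ'₁ Δ'₂) where

  private
    module S₁ = IsFaceSubdivision S₁
    module S₂ = IsFaceSubdivision S₂

    σ* : Face n → Face n
    σ* = joinMap Δ'₁ Δ'₂ σ₁ σ₂

    variable F₁ F₂ : Face n

    R₁ : Face n → Cx n
    R₁ = restr Δ'₁ σ₁

    R₂ : Face n → Cx n
    R₂ = restr Δ'₂ σ₂

    ∈-V₁⇒∉-V₂ : ∀ {x} → x ∈ vertices Δ₁ → x ∉ vertices Δ₂
    ∈-V₁⇒∉-V₂ = disjoint⇒∉ {A = Δ₁} {B = Δ₂} disjoint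

    ∈-V'₁⇒∉-V'₂ : ∀ {x} → x ∈ vertices Δ'₁ → x ∉ vertices Δ'₂
    ∈-V'₁⇒∉-V'₂ = disjoint⇒∉ {A = Δ'₁} {B = Δ'₂} disjoint'

  restr-joinMap⁺ : Δ₁ F₁ ≡ true → Δ₂ F₂ ≡ true →
    restr (join Δ'₁ Δ'₂) σ* (F₁ ∪ F₂) E ≡ true → join (R₁ F₁) (R₂ F₂) E ≡ true
  restr-joinMap⁺ {F₁ = F₁} {F₂ = F₂} {E = E} Δ₁F₁ Δ₂F₂ R with ∧-true⁻ {join Δ'₁ Δ'₂ E} R
  ... | J , σE⊆ᵇF with join-split S₁.source-complex S₂.source-complex disjoint' J
  ... | Δ'₁E₁ , Δ'₂E₂ , E₁∪E₂≡E =
    subst (λ S → join (R₁ F₁) (R₂ F₂) S ≡ true) E₁∪E₂≡E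
      (join⁺ {A = R₁ F₁} {B = R₂ F₂} (∧-true⁺ Δ'₁E₁ (⊆⇒⊆ᵇ σ₁E₁⊆F₁)) (∧-true⁺ Δ'₂E₂ (⊆⇒⊆ᵇ σ₂E₂⊆F₂)))
    where
    σE⊆F : σ* E ⊆ F₁ ∪ F₂
    σE⊆F = ⊆ᵇ⇒⊆ σE⊆ᵇF

    σ₁E₁⊆F₁ : σ₁ (E ∩ vertices Δ'₁) ⊆ F₁
    σ₁E₁⊆F₁ = ⊆-∪-cancelʳ (⊆-trans (p⊆p∪q _) σE⊆F) λ x∈σ₁E₁ x∈F₂ →
      ∈-V₁⇒∉-V₂ (face⊆vertices S₁.target-complex (S₁.face↦face _ Δ'₁E₁) x∈σ₁E₁)
                (face⊆vertices S₂.target-complex Δ₂F₂ x∈F₂)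

    σ₂E₂⊆F₂ : σ₂ (E ∩ vertices Δ'₂) ⊆ F₂
    σ₂E₂⊆F₂ = ⊆-∪-cancelˡ (⊆-trans (q⊆p∪q _ _) σE⊆F) λ x∈σ₂E₂ x∈F₁ →
      ∈-V₁⇒∉-V₂ (face⊆vertices S₁.target-complex Δ₁F₁ x∈F₁)
                (face⊆vertices S₂.target-complex (S₂.face↦face _ Δ'₂E₂) x∈σ₂E₂)

  restr-joinMap⁻ : join (R₁ F₁) (R₂ F₂) E ≡ true → restr (join Δ'₁ Δ'₂) σ* (F₁ ∪ F₂) E ≡ true
  restr-joinMap⁻ {F₁ = F₁} {F₂ = F₂} J with join⁻ {A = R₁ F₁} {B = R₂ F₂} J
  ... | X , Y , R₁X , R₂Y , refl with ∧-true⁻ {Δ'₁ X} R₁X | ∧-true⁻ {Δ'₂ Y} R₂Y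
  ... | Δ'₁X , σ₁X⊆F₁ | Δ'₂Y , σ₂Y⊆F₂
    with join-∩-vertices S₁.source-complex S₂.source-complex disjoint' Δ'₁X Δ'₂Y
  ... | X∪Y∩V'₁≡X , X∪Y∩V'₂≡Y =
    ∧-true⁺ (join⁺ {A = Δ'₁} {B = Δ'₂} Δ'₁X Δ'₂Y) (⊆⇒⊆ᵇ (subst (_⊆ F₁ ∪ F₂) σ₁X∪σ₂Y≡σX∪Y
      (∪-lub (⊆-trans (⊆ᵇ⇒⊆ σ₁X⊆F₁) (p⊆p∪q F₂)) (⊆-trans (⊆ᵇ⇒⊆ σ₂Y⊆F₂) (q⊆p∪q F₁ F₂)))))
    where
    σ₁X∪σ₂Y≡σX∪Y : σ₁ X ∪ σ₂ Y ≡ σ* (X ∪ Y)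
    σ₁X∪σ₂Y≡σX∪Y = sym (cong₂ (λ S T → σ₁ S ∪ σ₂ T) X∪Y∩V'₁≡X X∪Y∩V'₂≡Y)

  restr-joinMap : Δ₁ F₁ ≡ true → Δ₂ F₂ ≡ true →
    restr (join Δ'₁ Δ'₂) σ* (F₁ ∪ F₂) ≗ join (R₁ F₁) (R₂ F₂)
  restr-joinMap Δ₁F₁ Δ₂F₂ E = ≡-true-ext (restr-joinMap⁺ Δ₁F₁ Δ₂F₂) restr-joinMap⁻

  joinMap-vertexInduced : IsVertexInduced Δ'₁ Δ₁ σ₁ → IsVertexInduced Δ'₂ Δ₂ σ₂ →
    IsVertexInduced (join Δ'₁ Δ'₂) (join Δ₁ Δ₂) σ*
  joinMap-vertexInduced vertexInduced₁ vertexInduced₂ E F J F∈J vertices-in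
    with join⁻ {A = Δ₁} {B = Δ₂} F∈J
  ... | F₁ , F₂ , Δ₁F₁ , Δ₂F₂ , refl with join-split S₁.source-complex S₂.source-complex disjoint' J
  ... | Δ'₁E₁ , Δ'₂E₂ , E₁∪E₂≡E =
    restr-joinMap⁻ (subst (λ S → join (R₁ F₁) (R₂ F₂) S ≡ true) E₁∪E₂≡E
      (join⁺ {A = R₁ F₁} {B = R₂ F₂} (vertexInduced₁ _ F₁ Δ'₁E₁ Δ₁F₁ vertices-in₁)
                                      (vertexInduced₂ _ F₂ Δ'₂E₂ Δ₂F₂ vertices-in₂)))
    where
    complex₁ : IsComplex (R₁ F₁)
    complex₁ = S₁.restr-complex F₁ Δ₁F₁

    complex₂ : IsComplex (R₂ F₂)
    complex₂ = S₂.restr-complex F₂ Δ₂F₂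

    vertex-in : ∀ v → v ∈ E → join (R₁ F₁) (R₂ F₂) ⁅ v ⁆ ≡ true
    vertex-in v v∈E = restr-joinMap⁺ Δ₁F₁ Δ₂F₂ (vertices-in v v∈E)

    vertices-in₁ : ∀ v → v ∈ E ∩ vertices Δ'₁ → R₁ F₁ ⁅ v ⁆ ≡ true
    vertices-in₁ v v∈E₁ = join-faceˡ complex₁ complex₂ (vertex-in v (p∩q⊆p _ _ v∈E₁)) λ x∈⁅v⁆ x∈V₂ →
      ∈-V'₁⇒∉-V'₂ (⁅⁆⊆ (p∩q⊆q _ _ v∈E₁) x∈⁅v⁆) (vertices-mono (restr⊑ Δ'₂ σ₂ F₂) x∈V₂)

    vertices-in₂ : ∀ v → v ∈ E ∩ vertices Δ'₂ → R₂ F₂ ⁅ v ⁆ ≡ true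
    vertices-in₂ v v∈E₂ = join-faceʳ complex₁ complex₂ (vertex-in v (p∩q⊆p _ _ v∈E₂)) λ x∈⁅v⁆ x∈V₁ →
      ∈-V'₁⇒∉-V'₂ (vertices-mono (restr⊑ Δ'₁ σ₁ F₁) x∈V₁) (⁅⁆⊆ (p∩q⊆q _ _ v∈E₂) x∈⁅v⁆)

  joinMap-flag : IsFlagSubdivision Δ'₁ Δ₁ σ₁ → IsFlagSubdivision Δ'₂ Δ₂ σ₂ →
    IsFlagSubdivision (join Δ'₁ Δ'₂) (join Δ₁ Δ₂) σ*
  joinMap-flag flag₁ flag₂ F F∈J with join⁻ {A = Δ₁} {B = Δ₂} F∈J
  ... | F₁ , F₂ , Δ₁F₁ , Δ₂F₂ , refl =
    IsFlag-resp-≗ (restr-joinMap Δ₁F₁ Δ₂F₂)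
      (join-isFlag (S₁.restr-complex F₁ Δ₁F₁) (S₂.restr-complex F₂ Δ₂F₂)
        (disjoint-mono (restr⊑ Δ'₁ σ₁ F₁) (restr⊑ Δ'₂ σ₂ F₂) disjoint')
        (flag₁ F₁ Δ₁F₁) (flag₂ F₂ Δ₂F₂))

lemma2p5 : ∀ {c ℓ : Level} (K : Field c ℓ) {n : ℕ} →
  -- (1) joins of subdivisions
  (∀ (Δ₁ Δ₂ Δ'₁ Δ'₂ : Cx n) (σ₁ σ₂ : Face n → Face n) →
     IsHomologySubdivision K Δ'₁ Δ₁ σ₁ →
     IsHomologySubdivision K Δ'₂ Δ₂ σ₂ →
     DisjointVertices Δ₁ Δ₂ → DisjointVertices Δ'₁ Δ'₂ →
     (IsVertexInduced Δ'₁ Δ₁ σ₁ → IsVertexInduced Δ'₂ Δ₂ σ₂ →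
        IsVertexInduced (join Δ'₁ Δ'₂) (join Δ₁ Δ₂) (joinMap Δ'₁ Δ'₂ σ₁ σ₂))
     × (IsFlagSubdivision Δ'₁ Δ₁ σ₁ → IsFlagSubdivision Δ'₂ Δ₂ σ₂ →
        IsFlagSubdivision (join Δ'₁ Δ'₂) (join Δ₁ Δ₂) (joinMap Δ'₁ Δ'₂ σ₁ σ₂)))
  ×
  -- (2) restriction to links
  (∀ (Δ Δ' : Cx n) (σ : Face n → Face n) (F : Face n) →
     IsHomologySubdivision K Δ' Δ σ →
     Δ F ≡ true → Δ' F ≡ true → σ F ≡ F →
     (IsVertexInduced Δ' Δ σ →
        IsVertexInduced (link Δ' F) (link Δ F) (linkMap σ F))
     × (IsFlagSubdivision Δ' Δ σ →
        IsFlagSubdivision (link Δ' F) (link Δ F) (linkMap σ F)))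
lemma2p5 K =
  (λ Δ₁ Δ₂ Δ'₁ Δ'₂ σ₁ σ₂ S₁ S₂ disjoint disjoint' →
     let open JoinMap (homology⇒faceSubdivision K S₁) (homology⇒faceSubdivision K S₂)
                      disjoint disjoint'
     in joinMap-vertexInduced , joinMap-flag)
  , λ Δ Δ' σ F S _ Δ'F σF≡F →   -- Δ F ≡ true follows from Δ' F ≡ true and σ F ≡ F
      linkMap-vertexInduced (homology⇒faceSubdivision K S) Δ'F σF≡F
      , linkMap-flag (homology⇒faceSubdivision K S) Δ'F σF≡F
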